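{- Let $\Gamma=\mathrm{WH}_n(a,b,c,d)$ be a vertex-transitive Woolly Hat graph such that $n$ is even, $b,d\neq 0$, $2a=d-b$, the $2$-part of $\gcd(c,n)$ exceeds that of $\gcd(a,n)$, and the two $\mathrm{Aut}(\Gamma)$-orbits on edges are the set of all left, right and $c$-edges and the set of all $a$-, $b$- and $d$-edges. Suppose moreover that $4a=0$ and $4c=4b+n/2$ in $\mathbb{Z}_n$. Then $n=8$, $c\in\{0,4\}$, and either $\{b,d\}=\{1,5\}$ or $\{ -b,-d\}=\{1,5\}$.
   Context: For an integer $n\ge 3$ and $a,b,c,d\in\mathbb{Z}_n$ with $2a\neq 0$, $b,c,d$ pairwise distinct, and such that no prime divides $n$ together with (integer representatives of) all of $a,b,c,d$, the Woolly Hat graph $\mathrm{WH}_n(a,b,c,d)$ is the graph with vertex set $\{A_i,B_i,C_i : i\in\mathbb{Z}_n\}$ with adjacencies, for each $i\in\mathbb{Z}_n$ (subscripts mod $n$): $A_i\sim A_{i-a},A_{i+a},B_i,C_i$; $B_i\sim A_i,C_{i+b},C_{i+c},C_{i+d}$; $C_i\sim A_i,B_{i-b},B_{i-c},B_{i-d}$. The $a$-edges are $A_iA_{i+a}$, the left edges $A_iB_i$, the right edges $A_iC_i$, and for $x\in\{b,c,d\}$ the $x$-edges are $B_iC_{i+x}$. The $2$-part of a positive integer is the largest power of $2$ dividing it. -}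

module Defs where

open import Data.Nat using (ℕ; zero; suc; _+_; _*_; _∸_; _^_; _≤_; _<_; NonZero)
open import Data.Nat.DivMod using (_mod_; _/_)
open import Data.Nat.Divisibility using (_∣_)
open import Data.Nat.GCD using (gcd)
open import Data.Nat.Primality using (Prime)
open import Data.Fin using (Fin; toℕ)
open import Data.Product using (Σ; ∃; _×_; _,_)
open import Data.Sum using (_⊎_)
open import Data.Empty using (⊥)
open import Relation.Nullary using (¬_)
open import Relation.Binary.PropositionalEquality using (_≡_)
open import Function.Bundles using (_↔_; Inverse)

-- Arithmetic in ℤ_n, with ℤ_n represented by Fin n (representatives 0..n-1)

module _ {n : ℕ} {{_ : NonZero n}} where

  infixl 6 _+ₙ_ _-ₙ_

  _+ₙ_ : Fin n → Fin n → Fin n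
  i +ₙ j = (toℕ i + toℕ j) mod n

  -ₙ_ : Fin n → Fin n
  -ₙ i = (n ∸ toℕ i) mod n

  _-ₙ_ : Fin n → Fin n → Fin n
  i -ₙ j = i +ₙ (-ₙ j)

  _·ₙ_ : ℕ → Fin n → Fin n
  k ·ₙ i = (k * toℕ i) mod n

  [_]ₙ : ℕ → Fin n
  [ m ]ₙ = m mod n

TwoPart : ℕ → ℕ → Set
TwoPart m t = Σ ℕ λ k → t ≡ 2 ^ k × (2 ^ k ∣ m) × ¬ (2 ^ suc k ∣ m)

record WHParams (n : ℕ) {{_ : NonZero n}} (a b c d : Fin n) : Set where
  field
    n≥3      : 3 ≤ n
    2a≢0     : ¬ (2 ·ₙ a ≡ [ 0 ]ₙ)
    b≢c      : ¬ (b ≡ c)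
    b≢d      : ¬ (b ≡ d)
    c≢d      : ¬ (c ≡ d)
    noCommonPrime : ∀ p → Prime p → p ∣ n → p ∣ toℕ a → p ∣ toℕ b
                    → p ∣ toℕ c → p ∣ toℕ d → ⊥

data V (n : ℕ) : Set where
  A B C : Fin n → V n

module WH (n : ℕ) {{_ : NonZero n}} (a b c d : Fin n) where

  Adj : V n → V n → Set
  Adj (A i) (A j) = (j ≡ i -ₙ a) ⊎ (j ≡ i +ₙ a)
  Adj (A i) (B j) = j ≡ i
  Adj (A i) (C j) = j ≡ i
  Adj (B i) (A j) = j ≡ i
  Adj (B i) (C j) = (j ≡ i +ₙ b) ⊎ (j ≡ i +ₙ c) ⊎ (j ≡ i +ₙ d)
  Adj (C i) (A j) = j ≡ i
  Adj (C i) (B j) = (j ≡ i -ₙ b) ⊎ (j ≡ i -ₙ c) ⊎ (j ≡ i -ₙ d)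
  Adj (B i) (B j) = ⊥
  Adj (C i) (C j) = ⊥

  IsAut : (V n ↔ V n) → Set
  IsAut σ = ∀ u v → (Adj u v → Adj (f u) (f v)) × (Adj (f u) (f v) → Adj u v)
    where f = Inverse.to σ

  Aut : Set
  Aut = Σ (V n ↔ V n) IsAut

  app : Aut → V n → V n
  app (σ , _) = Inverse.to σ

  VertexTransitive : Set
  VertexTransitive = ∀ u v → Σ Aut λ σ → app σ u ≡ v

  SameEdgeOrbit : V n → V n → V n → V n → Set
  SameEdgeOrbit u u' v v' = Σ Aut λ σ →
    (app σ u ≡ v × app σ u' ≡ v') ⊎ (app σ u ≡ v' × app σ u' ≡ v)

  AEdge' LeftEdge' RightEdge' : V n → V n → Set
  AEdge' (A i) (A j) = j ≡ i +ₙ a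
  AEdge' _ _ = ⊥
  LeftEdge' (A i) (B j) = j ≡ i
  LeftEdge' _ _ = ⊥
  RightEdge' (A i) (C j) = j ≡ i
  RightEdge' _ _ = ⊥

  XEdge' : Fin n → V n → V n → Set
  XEdge' x (B i) (C j) = j ≡ i +ₙ x
  XEdge' x _ _ = ⊥

  sym-closure : (V n → V n → Set) → V n → V n → Set
  sym-closure R u v = R u v ⊎ R v u

  AEdge LeftEdge RightEdge : V n → V n → Set
  AEdge = sym-closure AEdge'
  LeftEdge = sym-closure LeftEdge'
  RightEdge = sym-closure RightEdge'

  XEdge : Fin n → V n → V n → Set
  XEdge x = sym-closure (XEdge' x)

  Class₁ Class₂ : V n → V n → Set
  Class₁ u v = LeftEdge u v ⊎ RightEdge u v ⊎ XEdge c u v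
  Class₂ u v = AEdge u v ⊎ XEdge b u v ⊎ XEdge d u v

  EdgeOrbitsAre₁₂ : Set
  EdgeOrbitsAre₁₂ = ∀ u u' v v' → Adj u u' → Adj v v' →
    (SameEdgeOrbit u u' v v' → (Class₁ u u' × Class₁ v v') ⊎ (Class₂ u u' × Class₂ v v'))
    × ((Class₁ u u' × Class₁ v v') ⊎ (Class₂ u u' × Class₂ v v') → SameEdgeOrbit u u' v v')

module Submission where

-- Write n = 2h.  From 4a ≡ 0 and 2a ≢ 0 we get 2a ≡ h, and then 4c ≡ 4b + h forces
-- a + b − c + y ≡ c for y = b or y = d.  This closes the 7-cycle
--   B₀ A₀ A_a B_a C_{a+b} B_{a+b−c} C_{a+b−c+y}
-- whose edges alternate between the two prescribed orbits, starting and ending with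
-- class 1.  An automorphism taking B₀ to A₀ maps it to such a cycle through A₀, whose
-- class-1 neighbours are only B₀ and C₀; the class-2/class-1 paths from B₀ to C₀ go
-- either through an a-edge or through two c-edges, giving a linear relation among a,
-- b, c, d.  Now 4(c − b) ≡ h mod 2h gives h = 4M with c − b an odd multiple of M, and
-- either relation makes M divide b, hence a, b, c, d and n = 8M.  No prime divides
-- all of n, a, b, c, d, so M = ±1 and n = 8; the rest is a finite check in ℤ₈.

open import Defs
open import Data.Nat using (ℕ; _<_; NonZero)
open import Data.Nat.DivMod using (_/_)
open import Data.Nat.Divisibility using (_∣_)
open import Data.Nat.GCD using (gcd)
open import Data.Fin using (Fin; toℕ)
open import Data.Product using (_×_)
open import Data.Sum using (_⊎_)
open import Relation.Nullary using (¬_)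
open import Relation.Binary.PropositionalEquality using (_≡_)

import Data.Nat as ℕ
import Data.Nat.Properties as ℕ
open import Data.Nat.DivMod using (_divMod_; module DivMod; m<n⇒m%n≡m; m*n/n≡m)
open import Data.Nat.Divisibility using (divides; ∣-refl; ∣-trans; ∣⇒≤; n∣m⇒m%n≡0)
open import Data.Nat.Primality using (Prime)
open import Data.Nat.Primality.Factorisation using (factorise)
open import Data.Fin as Fin using ()
open import Data.Fin.Properties using (toℕ<n; toℕ≤n; toℕ-injective; all?)
open import Data.Integer as ℤ using (ℤ; +_; _+_; _-_; _*_; -_; 0ℤ; ∣_∣; _⊖_; _%ℕ_; _/ℕ_)
import Data.Integer.Properties as ℤ
open import Data.Integer.DivMod using (n%ℕd<d; a≡a%ℕn+[a/ℕn]*n)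
open import Data.Integer.Divisibility.Signed as ℤ∣ using (∣⇒∣ᵤ) renaming (_∣_ to _∣ℤ_)
open import Data.Integer.Tactic.RingSolver using (solve)
open import Data.List using ([]; _∷_)
open import Data.Nat.ListAction using (product)
import Data.List.Relation.Unary.All as All
open import Data.Empty using (⊥; ⊥-elim)
open import Data.Product using (∃; _,_; proj₁; proj₂)
open import Data.Sum using (inj₁; inj₂; [_,_]′)
import Data.Sum as Sum
open import Function using (id; _∘_)
open import Function.Bundles using (Injection)
open import Function.Properties.Inverse using (↔⇒↣)
open import Level using (0ℓ)
open import Relation.Nullary.Decidable using (from-yes; ¬?; _→-dec_; _⊎-dec_; _×-dec_)
open import Relation.Binary.Bundles using (Setoid)
import Relation.Binary.Reasoning.Setoid as SetoidReasoning
open import Relation.Binary.PropositionalEquality as ≡ using (cong; subst; module ≡-Reasoning)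

-- Congruences of integers

infix 4 _≡_mod_
record _≡_mod_ (x y N : ℤ) : Set where
  constructor ≡-mod
  field N∣x-y : N ∣ℤ x - y
open _≡_mod_ public

module Mod {N : ℤ} where

  private
    by : ∀ {u v} → N ∣ℤ u → u ≡ v → N ∣ℤ v
    by p eq = subst (N ∣ℤ_) eq p

  from-multiple : ∀ {x y} q → x ≡ y + q * N → x ≡ y mod N
  from-multiple {x} {y} q eq = ≡-mod (ℤ∣.divides q (begin
    x - y           ≡⟨ cong (_- y) eq ⟩
    y + q * N - y   ≡⟨ solve (y ∷ q ∷ N ∷ []) ⟩
    q * N           ∎))
    where open ≡-Reasoning

  to-multiple : ∀ {x y} → x ≡ y mod N → ∃ λ q → x ≡ y + q * N
  to-multiple {x} {y} (≡-mod (ℤ∣.divides q eq)) = q , (begin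
    x               ≡⟨ solve (x ∷ y ∷ []) ⟩
    y + (x - y)     ≡⟨ cong (λ e → y + e) eq ⟩
    y + q * N       ∎)
    where open ≡-Reasoning

  reflexive : ∀ {x y} → x ≡ y → x ≡ y mod N
  reflexive {x} ≡.refl = from-multiple 0ℤ (solve (x ∷ N ∷ []))

  refl : ∀ {x} → x ≡ x mod N
  refl = reflexive ≡.refl

  sym : ∀ {x y} → x ≡ y mod N → y ≡ x mod N
  sym {x} {y} (≡-mod p) = ≡-mod (by (ℤ∣.∣m⇒∣-m p) (solve (x ∷ y ∷ [])))

  trans : ∀ {x y z} → x ≡ y mod N → y ≡ z mod N → x ≡ z mod N
  trans {x} {y} {z} (≡-mod p) (≡-mod q) = ≡-mod (by (ℤ∣.∣m∣n⇒∣m+n p q) (solve (x ∷ y ∷ z ∷ [])))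

  +-cong : ∀ {x y u v} → x ≡ y mod N → u ≡ v mod N → x + u ≡ y + v mod N
  +-cong {x} {y} {u} {v} (≡-mod p) (≡-mod q) =
    ≡-mod (by (ℤ∣.∣m∣n⇒∣m+n p q) (solve (x ∷ y ∷ u ∷ v ∷ [])))

  +-congˡ : ∀ x {u v} → u ≡ v mod N → x + u ≡ x + v mod N
  +-congˡ x = +-cong (refl {x})

  +-congʳ : ∀ x {u v} → u ≡ v mod N → u + x ≡ v + x mod N
  +-congʳ x p = +-cong p (refl {x})

  -‿cong : ∀ {x y} → x ≡ y mod N → - x ≡ - y mod N
  -‿cong {x} {y} (≡-mod p) = ≡-mod (by (ℤ∣.∣m⇒∣-m p) (solve (x ∷ y ∷ [])))

  *-congˡ : ∀ k {x y} → x ≡ y mod N → k * x ≡ k * y mod N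
  *-congˡ k {x} {y} (≡-mod p) = ≡-mod (by (ℤ∣.∣n⇒∣m*n k p) (solve (k ∷ x ∷ y ∷ [])))

  setoid : Setoid 0ℓ 0ℓ
  setoid = record { _≈_ = _≡_mod N ; isEquivalence = record { refl = refl ; sym = sym ; trans = trans } }

  module Reasoning = SetoidReasoning setoid

  +-cancelˡ : ∀ x {u v} → x + u ≡ x + v mod N → u ≡ v mod N
  +-cancelˡ x {u} {v} p = begin
    u              ≡⟨ solve (x ∷ u ∷ []) ⟩
    x + u - x      ≈⟨ +-congʳ (- x) p ⟩
    x + v - x      ≡⟨ solve (x ∷ v ∷ []) ⟩
    v              ∎
    where open Reasoning

  ∣⇒≡0 : ∀ {x} → N ∣ℤ x → x ≡ 0ℤ mod N
  ∣⇒≡0 {x} p = ≡-mod (by p (≡.sym (ℤ.+-identityʳ x)))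

  ≡0⇒∣ : ∀ {x} → x ≡ 0ℤ mod N → N ∣ℤ x
  ≡0⇒∣ {x} (≡-mod p) = by p (ℤ.+-identityʳ x)

  N≡0 : N ≡ 0ℤ mod N
  N≡0 = ∣⇒≡0 ℤ∣.∣-refl

-- A record rather than v ≡ u + x mod N, so that u, x and v are recovered by
-- unification (ℤ's _+_ is not injective).
infix 4 _⟶[_]_mod_
record _⟶[_]_mod_ (u x v N : ℤ) : Set where
  constructor step
  field v≡u+x : v ≡ u + x mod N

module _ {N : ℤ} where

  ⟶-trans : ∀ {u v w x y} → u ⟶[ x ] v mod N → v ⟶[ y ] w mod N → u ⟶[ x + y ] w mod N
  ⟶-trans {u} {v} {w} {x} {y} (step p) (step q) = step (begin
    w              ≈⟨ q ⟩
    v + y          ≈⟨ Mod.+-congʳ y p ⟩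
    u + x + y      ≡⟨ ℤ.+-assoc u x y ⟩
    u + (x + y)    ∎)
    where open Mod.Reasoning

  ⟶-sym : ∀ {u v x} → u ⟶[ x ] v mod N → v ⟶[ - x ] u mod N
  ⟶-sym {u} {v} {x} (step p) = step (begin
    u              ≡⟨ solve (u ∷ x ∷ []) ⟩
    u + x + - x    ≈⟨ Mod.+-congʳ (- x) p ⟨
    v + - x        ∎)
    where open Mod.Reasoning

  ⟶-unique : ∀ {u v x y} → u ⟶[ x ] v mod N → u ⟶[ y ] v mod N → x ≡ y mod N
  ⟶-unique {u} (step p) (step q) = Mod.+-cancelˡ u (Mod.trans (Mod.sym p) q)

  ⟶-closed : ∀ {u x} → u ⟶[ x ] u mod N → x ≡ 0ℤ mod N
  ⟶-closed {u} p = ⟶-unique p (step (Mod.reflexive (≡.sym (ℤ.+-identityʳ u))))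

  ⟶-resp : ∀ {u v x y} → x ≡ y mod N → u ⟶[ x ] v mod N → u ⟶[ y ] v mod N
  ⟶-resp {u} x≡y (step p) = step (Mod.trans p (Mod.+-congˡ u x≡y))

weaken-modulus : ∀ {D N x y} → D ∣ℤ N → x ≡ y mod N → x ≡ y mod D
weaken-modulus D∣N (≡-mod p) = ≡-mod (ℤ∣.∣-trans D∣N p)

*-cancel-modulus : ∀ k {D x} .{{_ : ℤ.NonZero k}} → k * x ≡ 0ℤ mod k * D → x ≡ 0ℤ mod D
*-cancel-modulus k {D} {x} p = Mod.∣⇒≡0 (ℤ∣.*-cancelˡ-∣ k (Mod.≡0⇒∣ p))

parity : ∀ q → ∃ λ s → q ≡ + 2 * s ⊎ q ≡ + 2 * s + + 1
parity q = by-remainder (q %ℕ 2) (q /ℕ 2) (n%ℕd<d q 2) (a≡a%ℕn+[a/ℕn]*n q 2)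
  where
  by-remainder : ∀ r s → r ℕ.< 2 → q ≡ + r + s * + 2 → ∃ λ s → q ≡ + 2 * s ⊎ q ≡ + 2 * s + + 1
  by-remainder 0 s _ q≡ = s , inj₁ (≡.trans q≡ (solve (s ∷ [])))
  by-remainder 1 s _ q≡ = s , inj₂ (≡.trans q≡ (solve (s ∷ [])))
  by-remainder (ℕ.suc (ℕ.suc _)) _ (ℕ.s≤s (ℕ.s≤s ())) _

halve : ∀ {x H} → + 2 * x ≡ 0ℤ mod + 2 * H → x ≡ 0ℤ mod + 2 * H ⊎ x ≡ H mod + 2 * H
halve {x} {H} 2x≡0 = by-parity (Mod.to-multiple 2x≡0)
  where
  open ≡-Reasoning
  by-parity : (∃ λ q → + 2 * x ≡ 0ℤ + q * (+ 2 * H)) → x ≡ 0ℤ mod + 2 * H ⊎ x ≡ H mod + 2 * H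
  by-parity (q , 2x≡q2H) with parity q
  ... | s , inj₁ q≡2s = inj₁ (Mod.from-multiple s (ℤ.*-cancelˡ-≡ (+ 2) _ _ (begin
    + 2 * x                    ≡⟨ 2x≡q2H ⟩
    0ℤ + q * (+ 2 * H)         ≡⟨ cong (λ q → 0ℤ + q * (+ 2 * H)) q≡2s ⟩
    0ℤ + + 2 * s * (+ 2 * H)   ≡⟨ solve (s ∷ H ∷ []) ⟩
    + 2 * (0ℤ + s * (+ 2 * H)) ∎)))
  ... | s , inj₂ q≡2s+1 = inj₂ (Mod.from-multiple s (ℤ.*-cancelˡ-≡ (+ 2) _ _ (begin
    + 2 * x                          ≡⟨ 2x≡q2H ⟩
    0ℤ + q * (+ 2 * H)               ≡⟨ cong (λ q → 0ℤ + q * (+ 2 * H)) q≡2s+1 ⟩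
    0ℤ + (+ 2 * s + + 1) * (+ 2 * H) ≡⟨ solve (s ∷ H ∷ []) ⟩
    + 2 * (H + s * (+ 2 * H))        ∎)))

quarter : ∀ {X H} → + 4 * X ≡ H mod + 2 * H → ∃ λ M → H ≡ + 4 * M × (X ≡ M mod + 2 * M)
quarter {X} {H} p = from-quotient (Mod.to-multiple p)
  where
  open ≡-Reasoning
  from-quotient : (∃ λ t → + 4 * X ≡ H + t * (+ 2 * H)) → ∃ λ M → H ≡ + 4 * M × (X ≡ M mod + 2 * M)
  from-quotient (t , 4X≡) = M , H≡4M , Mod.from-multiple t (X≡M+2tM M H≡4M)
    where
    -- 4X = (1 + 2t)H and (1 + 2t)(1 − 2t) + 4t² = 1.
    M : ℤ
    M = X * (+ 1 - + 2 * t) + t * t * H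
    H≡4M : H ≡ + 4 * M
    H≡4M = begin
      H                                                          ≡⟨ solve (H ∷ t ∷ []) ⟩
      (H + t * (+ 2 * H)) * (+ 1 - + 2 * t) + + 4 * (t * t * H)  ≡⟨ cong (λ y → y * (+ 1 - + 2 * t) + _) 4X≡ ⟨
      + 4 * X * (+ 1 - + 2 * t) + + 4 * (t * t * H)              ≡⟨ solve (X ∷ t ∷ H ∷ []) ⟩
      + 4 * (X * (+ 1 - + 2 * t) + t * t * H)                    ∎
    X≡M+2tM : ∀ M → H ≡ + 4 * M → X ≡ M + t * (+ 2 * M)
    X≡M+2tM M H≡4M = ℤ.*-cancelˡ-≡ (+ 4) _ _ (begin
      + 4 * X                               ≡⟨ 4X≡ ⟩
      H + t * (+ 2 * H)                     ≡⟨ cong (λ h → h + t * (+ 2 * h)) H≡4M ⟩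
      + 4 * M + t * (+ 2 * (+ 4 * M))       ≡⟨ solve (M ∷ t ∷ []) ⟩
      + 4 * (M + t * (+ 2 * M))             ∎)

OneOf : {A : Set} → A → A → A → Set
OneOf x y z = z ≡ x ⊎ z ≡ y

-- What a path B_o → C_o with edge classes 2, 1, 2, 1, 2 forces: it uses either one
-- a-edge (in either direction) or two c-edges.
data CycleRelation (N a b c d : ℤ) : Set where
  through-a : ∀ {y₁ s y₃} → OneOf b d y₁ → OneOf a (- a) s → OneOf b d y₃ →
              y₁ + s + y₃ ≡ 0ℤ mod N → CycleRelation N a b c d
  through-c : ∀ {y₁ y₂ y₃} → OneOf b d y₁ → OneOf b d y₂ → OneOf b d y₃ →
              y₁ - c + y₂ - c + y₃ ≡ 0ℤ mod N → CycleRelation N a b c d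

cycle-relation-weaken : ∀ {D N a b c d} → D ∣ℤ N → CycleRelation N a b c d → CycleRelation D a b c d
cycle-relation-weaken D∣N (through-a y₁ s y₃ cycle)  = through-a y₁ s y₃ (weaken-modulus D∣N cycle)
cycle-relation-weaken D∣N (through-c y₁ y₂ y₃ cycle) = through-c y₁ y₂ y₃ (weaken-modulus D∣N cycle)

module _ {D a b c d : ℤ}
         (a≡0 : a ≡ 0ℤ mod D) (d≡b : d ≡ b mod D) (2[c-b]≡0 : + 2 * (c - b) ≡ 0ℤ mod D) where

  private
    y≡b : ∀ {y} → OneOf b d y → y ≡ b mod D
    y≡b (inj₁ ≡.refl) = Mod.refl
    y≡b (inj₂ ≡.refl) = d≡b

    s≡0 : ∀ {s} → OneOf a (- a) s → s ≡ 0ℤ mod D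
    s≡0 (inj₁ ≡.refl) = a≡0
    s≡0 (inj₂ ≡.refl) = Mod.-‿cong a≡0

  cycle-relation⇒2b≡0 : CycleRelation D a b c d → + 2 * b ≡ 0ℤ mod D
  cycle-relation⇒2b≡0 (through-a {y₁} {s} {y₃} y₁∈ s∈ y₃∈ cycle) = begin
    + 2 * b             ≡⟨ solve (b ∷ []) ⟩
    b + 0ℤ + b          ≈⟨ Mod.+-cong (Mod.+-cong (y≡b y₁∈) (s≡0 s∈)) (y≡b y₃∈) ⟨
    y₁ + s + y₃         ≈⟨ cycle ⟩
    0ℤ                  ∎
    where open Mod.Reasoning
  cycle-relation⇒2b≡0 (through-c {y₁} {y₂} {y₃} y₁∈ y₂∈ y₃∈ cycle) = Mod.*-congˡ (+ 2) (begin
    b                                  ≡⟨ solve (b ∷ c ∷ []) ⟩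
    b - c + b - c + b + + 2 * (c - b)  ≈⟨ Mod.+-congˡ (b - c + b - c + b) 2[c-b]≡0 ⟩
    b - c + b - c + b + 0ℤ             ≈⟨ Mod.+-congʳ 0ℤ y's≡b's ⟨
    y₁ - c + y₂ - c + y₃ + 0ℤ          ≈⟨ Mod.+-congʳ 0ℤ cycle ⟩
    0ℤ + 0ℤ                            ∎)
    where
    open Mod.Reasoning
    y's≡b's : y₁ - c + y₂ - c + y₃ ≡ b - c + b - c + b mod D
    y's≡b's = Mod.+-cong (Mod.+-congʳ (- c) (Mod.+-cong (Mod.+-congʳ (- c) (y≡b y₁∈)) (y≡b y₂∈))) (y≡b y₃∈)

module _ {H a b c d : ℤ}
         (4a≡0 : + 4 * a ≡ 0ℤ mod + 2 * H)
         (4c≡4b+H : + 4 * c ≡ + 4 * b + H mod + 2 * H)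
         (2a≡d-b : + 2 * a ≡ d - b mod + 2 * H) where

  2a≡H : ¬ (+ 2 * a ≡ 0ℤ mod + 2 * H) → + 2 * a ≡ H mod + 2 * H
  2a≡H 2a≢0 = [ (λ 2a≡0 → ⊥-elim (2a≢0 2a≡0)) , id ]′ (halve 2[2a]≡0)
    where
    2[2a]≡0 : + 2 * (+ 2 * a) ≡ 0ℤ mod + 2 * H
    2[2a]≡0 = begin
      + 2 * (+ 2 * a)  ≡⟨ solve (a ∷ []) ⟩
      + 4 * a          ≈⟨ 4a≡0 ⟩
      0ℤ               ∎
      where open Mod.Reasoning

  closing-condition : ¬ (+ 2 * a ≡ 0ℤ mod + 2 * H) →
                      ∃ λ y → OneOf b d y × (a + b - c + y ≡ c mod + 2 * H)
  closing-condition 2a≢0 = by-cases (halve 2δ≡0)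
    where
    open Mod.Reasoning
    2δ≡0 : + 2 * (+ 2 * (c - b) - a) ≡ 0ℤ mod + 2 * H
    2δ≡0 = begin
      + 2 * (+ 2 * (c - b) - a)       ≡⟨ solve (a ∷ b ∷ c ∷ []) ⟩
      + 4 * c - + 4 * b - + 2 * a     ≈⟨ Mod.+-cong (Mod.+-congʳ (- (+ 4 * b)) 4c≡4b+H) (Mod.-‿cong (2a≡H 2a≢0)) ⟩
      + 4 * b + H - + 4 * b - H       ≡⟨ solve (b ∷ H ∷ []) ⟩
      0ℤ                              ∎
    by-cases : (+ 2 * (c - b) - a ≡ 0ℤ mod + 2 * H) ⊎ (+ 2 * (c - b) - a ≡ H mod + 2 * H) →
               ∃ λ y → OneOf b d y × (a + b - c + y ≡ c mod + 2 * H)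
    by-cases (inj₁ δ≡0) = b , inj₁ ≡.refl , (begin
      a + b - c + b                         ≡⟨ solve (a ∷ b ∷ c ∷ []) ⟩
      c - (+ 2 * (c - b) - a)               ≈⟨ Mod.+-congˡ c (Mod.-‿cong δ≡0) ⟩
      c - 0ℤ                                ≡⟨ solve (c ∷ []) ⟩
      c                                     ∎)
    by-cases (inj₂ δ≡H) = d , inj₂ ≡.refl , (begin
      a + b - c + d                         ≡⟨ solve (a ∷ b ∷ c ∷ d ∷ []) ⟩
      a + + 2 * b - c + (d - b)             ≈⟨ Mod.+-congˡ (a + + 2 * b - c) (Mod.sym 2a≡d-b) ⟩
      a + + 2 * b - c + + 2 * a             ≈⟨ Mod.+-congˡ (a + + 2 * b - c) (2a≡H 2a≢0) ⟩
      a + + 2 * b - c + H                   ≈⟨ Mod.+-congˡ (a + + 2 * b - c) (Mod.sym δ≡H) ⟩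
      a + + 2 * b - c + (+ 2 * (c - b) - a) ≡⟨ solve (a ∷ b ∷ c ∷ []) ⟩
      c                                     ∎)

  common-divisor : CycleRelation (+ 2 * H) a b c d →
                   ∃ λ M → + 2 * H ≡ + 8 * M × M ∣ℤ a × M ∣ℤ b × M ∣ℤ c × M ∣ℤ d
  common-divisor relation = from-quarter (quarter 4[c-b]≡H)
    where
    open Mod.Reasoning
    4[c-b]≡H : + 4 * (c - b) ≡ H mod + 2 * H
    4[c-b]≡H = begin
      + 4 * (c - b)              ≡⟨ solve (b ∷ c ∷ []) ⟩
      + 4 * c - + 4 * b          ≈⟨ Mod.+-congʳ (- (+ 4 * b)) 4c≡4b+H ⟩
      + 4 * b + H - + 4 * b      ≡⟨ solve (b ∷ H ∷ []) ⟩
      H                          ∎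
    from-quarter : (∃ λ M → H ≡ + 4 * M × (c - b ≡ M mod + 2 * M)) →
                   ∃ λ M → + 2 * H ≡ + 8 * M × M ∣ℤ a × M ∣ℤ b × M ∣ℤ c × M ∣ℤ d
    from-quarter (M , H≡4M , c-b≡M) =
      M , 2H≡8M , Mod.≡0⇒∣ (mod-M a≡0) , Mod.≡0⇒∣ b≡0 , Mod.≡0⇒∣ c≡0 , Mod.≡0⇒∣ d≡0
      where
      2H≡8M : + 2 * H ≡ + 8 * M
      2H≡8M = ≡.trans (cong (+ 2 *_) H≡4M) (solve (M ∷ []))
      2H≡4[2M] : + 2 * H ≡ + 4 * (+ 2 * M)
      2H≡4[2M] = ≡.trans 2H≡8M (solve (M ∷ []))
      mod-M : ∀ {x y} → x ≡ y mod + 2 * M → x ≡ y mod M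
      mod-M = weaken-modulus (ℤ∣.divides (+ 2) ≡.refl)
      a≡0 : a ≡ 0ℤ mod + 2 * M
      a≡0 = *-cancel-modulus (+ 4) (subst (_ ≡ _ mod_) 2H≡4[2M] 4a≡0)
      d≡b : d ≡ b mod + 2 * M
      d≡b = begin
        d                  ≡⟨ solve (b ∷ d ∷ []) ⟩
        b + (d - b)        ≈⟨ Mod.+-congˡ b (weaken-modulus (ℤ∣.divides (+ 4) 2H≡4[2M]) (Mod.sym 2a≡d-b)) ⟩
        b + + 2 * a        ≈⟨ Mod.+-congˡ b (Mod.*-congˡ (+ 2) a≡0) ⟩
        b + + 2 * 0ℤ       ≡⟨ solve (b ∷ []) ⟩
        b                  ∎
      2[c-b]≡0 : + 2 * (c - b) ≡ 0ℤ mod + 2 * M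
      2[c-b]≡0 = Mod.trans (Mod.*-congˡ (+ 2) c-b≡M) Mod.N≡0
      b≡0 : b ≡ 0ℤ mod M
      b≡0 = *-cancel-modulus (+ 2) (cycle-relation⇒2b≡0 a≡0 d≡b 2[c-b]≡0
              (cycle-relation-weaken (ℤ∣.divides (+ 4) 2H≡4[2M]) relation))
      c≡0 : c ≡ 0ℤ mod M
      c≡0 = begin
        c                  ≡⟨ solve (b ∷ c ∷ []) ⟩
        b + (c - b)        ≈⟨ Mod.+-cong b≡0 (mod-M c-b≡M) ⟩
        0ℤ + M             ≈⟨ Mod.+-congˡ 0ℤ Mod.N≡0 ⟩
        0ℤ + 0ℤ            ∎
      d≡0 : d ≡ 0ℤ mod M
      d≡0 = Mod.trans (mod-M d≡b) b≡0

-- ℤₙ inside ℤ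

module Residues (n : ℕ) {{_ : NonZero n}} where

  ⟦_⟧ : Fin n → ℤ
  ⟦ i ⟧ = + toℕ i

  ⟦⟧-[]ₙ : ∀ m → ⟦ [ m ]ₙ ⟧ ≡ + m mod + n
  ⟦⟧-[]ₙ m = Mod.sym (Mod.from-multiple (+ (m / n)) (begin
    + m                                    ≡⟨ cong +_ (DivMod.property (m divMod n)) ⟩
    + (toℕ [ m ]ₙ ℕ.+ m / n ℕ.* n)         ≡⟨ ℤ.pos-+ (toℕ [ m ]ₙ) (m / n ℕ.* n) ⟩
    ⟦ [ m ]ₙ ⟧ + + (m / n ℕ.* n)           ≡⟨ cong (λ k → ⟦ [ m ]ₙ ⟧ + k) (ℤ.pos-* (m / n) n) ⟩
    ⟦ [ m ]ₙ ⟧ + + (m / n) * + n           ∎))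
    where open ≡-Reasoning

  ⟦⟧-+ₙ : ∀ i j → ⟦ i +ₙ j ⟧ ≡ ⟦ i ⟧ + ⟦ j ⟧ mod + n
  ⟦⟧-+ₙ i j = Mod.trans (⟦⟧-[]ₙ _) (Mod.reflexive (ℤ.pos-+ (toℕ i) (toℕ j)))

  ⟦⟧-·ₙ : ∀ k i → ⟦ k ·ₙ i ⟧ ≡ + k * ⟦ i ⟧ mod + n
  ⟦⟧-·ₙ k i = Mod.trans (⟦⟧-[]ₙ _) (Mod.reflexive (ℤ.pos-* k (toℕ i)))

  ⟦⟧-neg : ∀ i → ⟦ -ₙ i ⟧ ≡ - ⟦ i ⟧ mod + n
  ⟦⟧-neg i = begin
    ⟦ -ₙ i ⟧              ≈⟨ ⟦⟧-[]ₙ _ ⟩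
    + (n ℕ.∸ toℕ i)       ≡⟨ ℤ.⊖-≥ (toℕ≤n i) ⟨
    n ⊖ toℕ i             ≡⟨ ℤ.m-n≡m⊖n n (toℕ i) ⟨
    + n + - ⟦ i ⟧         ≈⟨ Mod.+-congʳ (- ⟦ i ⟧) Mod.N≡0 ⟩
    0ℤ + - ⟦ i ⟧          ≡⟨ ℤ.+-identityˡ (- ⟦ i ⟧) ⟩
    - ⟦ i ⟧               ∎
    where open Mod.Reasoning

  ⟦⟧-sub : ∀ i j → ⟦ i -ₙ j ⟧ ≡ ⟦ i ⟧ - ⟦ j ⟧ mod + n
  ⟦⟧-sub i j = Mod.trans (⟦⟧-+ₙ i (-ₙ j)) (Mod.+-congˡ ⟦ i ⟧ (⟦⟧-neg j))

  ⟦⟧-injective : ∀ {i j} → ⟦ i ⟧ ≡ ⟦ j ⟧ mod + n → i ≡ j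
  ⟦⟧-injective {i} {j} (≡-mod n∣i-j) =
    toℕ-injective (ℤ.+-injective (ℤ.i-j≡0⇒i≡j _ _ (ℤ.∣i∣≡0⇒i≡0 ∣i-j∣≡0)))
    where
    ∣i-j∣<n : ∣ ⟦ i ⟧ - ⟦ j ⟧ ∣ ℕ.< n
    ∣i-j∣<n = begin-strict
      ∣ ⟦ i ⟧ - ⟦ j ⟧ ∣       ≡⟨ cong ∣_∣ (ℤ.m-n≡m⊖n (toℕ i) (toℕ j)) ⟩
      ∣ toℕ i ⊖ toℕ j ∣       ≤⟨ ℤ.∣m⊝n∣≤m⊔n (toℕ i) (toℕ j) ⟩
      toℕ i ℕ.⊔ toℕ j         <⟨ ℕ.⊔-pres-<m (toℕ<n i) (toℕ<n j) ⟩
      n                       ∎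
      where open ℕ.≤-Reasoning
    ∣i-j∣≡0 : ∣ ⟦ i ⟧ - ⟦ j ⟧ ∣ ≡ 0
    ∣i-j∣≡0 = ≡.trans (≡.sym (m<n⇒m%n≡m ∣i-j∣<n)) (n∣m⇒m%n≡0 _ n (∣⇒∣ᵤ n∣i-j))

  ⟦⟧-step : ∀ i x {j} → j ≡ i +ₙ x → ⟦ i ⟧ ⟶[ ⟦ x ⟧ ] ⟦ j ⟧ mod + n
  ⟦⟧-step i x ≡.refl = step (⟦⟧-+ₙ i x)

  step⇒+ₙ : ∀ {i x j} → ⟦ i ⟧ ⟶[ ⟦ x ⟧ ] ⟦ j ⟧ mod + n → j ≡ i +ₙ x
  step⇒+ₙ {i} {x} (step p) = ⟦⟧-injective (Mod.trans p (Mod.sym (⟦⟧-+ₙ i x)))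

  step⇒-ₙ : ∀ {i x j} → ⟦ i ⟧ ⟶[ ⟦ x ⟧ ] ⟦ j ⟧ mod + n → i ≡ j -ₙ x
  step⇒-ₙ {x = x} {j} p = ⟦⟧-injective (Mod.trans (v≡u+x (⟶-sym p)) (Mod.sym (⟦⟧-sub j x)))
    where open _⟶[_]_mod_

  -ₙ+ₙ : ∀ i x → i ≡ (i -ₙ x) +ₙ x
  -ₙ+ₙ i x = step⇒+ₙ (⟶-resp (Mod.reflexive (ℤ.neg-involutive ⟦ x ⟧)) (⟶-sym (step (⟦⟧-sub i x))))

-- The Woolly Hat graph

module WoollyHat (n : ℕ) {{_ : NonZero n}} (a b c d : Fin n) where

  open WH n a b c d
  open Residues n

  CycleRelationₙ : Set
  CycleRelationₙ = CycleRelation (+ n) ⟦ a ⟧ ⟦ b ⟧ ⟦ c ⟧ ⟦ d ⟧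

  ⟦⟧-oneOf : ∀ {y} → OneOf b d y → OneOf ⟦ b ⟧ ⟦ d ⟧ ⟦ y ⟧
  ⟦⟧-oneOf = Sum.map (≡.cong ⟦_⟧) (≡.cong ⟦_⟧)

  sym-map : ∀ {R S : V n → V n → Set} → (∀ u v → R u v → S u v) →
            ∀ {u v} → sym-closure R u v → sym-closure S u v
  sym-map f = Sum.map (f _ _) (f _ _)

  -- Class₁ and Class₂ in one orientation, as inductive families: matching on them
  -- discards impossible endpoints by unification.
  data Edge₁ : V n → V n → Set where
    left   : ∀ i → Edge₁ (A i) (B i)
    right  : ∀ i → Edge₁ (A i) (C i)
    c-edge : ∀ {i j} → ⟦ i ⟧ ⟶[ ⟦ c ⟧ ] ⟦ j ⟧ mod + n → Edge₁ (B i) (C j)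

  data Edge₂ : V n → V n → Set where
    a-edge  : ∀ {i j} → ⟦ i ⟧ ⟶[ ⟦ a ⟧ ] ⟦ j ⟧ mod + n → Edge₂ (A i) (A j)
    bd-edge : ∀ {i j y} → OneOf b d y → ⟦ i ⟧ ⟶[ ⟦ y ⟧ ] ⟦ j ⟧ mod + n → Edge₂ (B i) (C j)

  left-view : ∀ u v → LeftEdge' u v → Edge₁ u v
  left-view (A i) (B _) ≡.refl = left i
  left-view (A _) (A _) ()
  left-view (A _) (C _) ()
  left-view (B _) _ ()
  left-view (C _) _ ()

  right-view : ∀ u v → RightEdge' u v → Edge₁ u v
  right-view (A i) (C _) ≡.refl = right i
  right-view (A _) (A _) ()
  right-view (A _) (B _) ()
  right-view (B _) _ ()
  right-view (C _) _ ()

  a-view : ∀ u v → AEdge' u v → Edge₂ u v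
  a-view (A i) (A _) eq = a-edge (⟦⟧-step i a eq)
  a-view (A _) (B _) ()
  a-view (A _) (C _) ()
  a-view (B _) _ ()
  a-view (C _) _ ()

  x-view : ∀ {x} (E : V n → V n → Set) → (∀ {i j} → ⟦ i ⟧ ⟶[ ⟦ x ⟧ ] ⟦ j ⟧ mod + n → E (B i) (C j)) →
           ∀ u v → XEdge' x u v → E u v
  x-view {x} E edge (B i) (C _) eq = edge (⟦⟧-step i x eq)
  x-view E edge (B _) (A _) ()
  x-view E edge (B _) (B _) ()
  x-view E edge (A _) _ ()
  x-view E edge (C _) _ ()

  class₁-view : ∀ {u v} → Class₁ u v → sym-closure Edge₁ u v
  class₁-view = [ sym-map left-view , [ sym-map right-view , sym-map (x-view Edge₁ c-edge) ]′ ]′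

  class₂-view : ∀ {u v} → Class₂ u v → sym-closure Edge₂ u v
  class₂-view = [ sym-map a-view , [ sym-map (x-view Edge₂ (bd-edge (inj₁ ≡.refl)))
                                  , sym-map (x-view Edge₂ (bd-edge (inj₂ ≡.refl))) ]′ ]′

  edge₁-adjacent : ∀ {u v} → Edge₁ u v → Adj u v × Adj v u
  edge₁-adjacent (left i)   = ≡.refl , ≡.refl
  edge₁-adjacent (right i)  = ≡.refl , ≡.refl
  edge₁-adjacent (c-edge s) = inj₂ (inj₁ (step⇒+ₙ s)) , inj₂ (inj₁ (step⇒-ₙ s))

  edge₂-adjacent : ∀ {u v} → Edge₂ u v → Adj u v × Adj v u
  edge₂-adjacent (a-edge s)                = inj₂ (step⇒+ₙ s) , inj₁ (step⇒-ₙ s)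
  edge₂-adjacent (bd-edge (inj₁ ≡.refl) s) = inj₁ (step⇒+ₙ s) , inj₁ (step⇒-ₙ s)
  edge₂-adjacent (bd-edge (inj₂ ≡.refl) s) = inj₂ (inj₂ (step⇒+ₙ s)) , inj₂ (inj₂ (step⇒-ₙ s))

  class₁-adjacent : ∀ {u v} → Class₁ u v → Adj u v
  class₁-adjacent = [ proj₁ ∘ edge₁-adjacent , proj₂ ∘ edge₁-adjacent ]′ ∘ class₁-view

  class₂-adjacent : ∀ {u v} → Class₂ u v → Adj u v
  class₂-adjacent = [ proj₁ ∘ edge₂-adjacent , proj₂ ∘ edge₂-adjacent ]′ ∘ class₂-view

  module _ (b≢c : ¬ b ≡ c) (c≢d : ¬ c ≡ d) where

    c∉bd : ∀ {y} → OneOf b d y → ¬ c ≡ y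
    c∉bd (inj₁ ≡.refl) = b≢c ∘ ≡.sym
    c∉bd (inj₂ ≡.refl) = c≢d

    edges-disjoint : ∀ {u v} → sym-closure Edge₁ u v → sym-closure Edge₂ u v → ⊥
    edges-disjoint (inj₁ (c-edge s)) (inj₁ (bd-edge y s')) = c∉bd y (⟦⟧-injective (⟶-unique s s'))
    edges-disjoint (inj₂ (c-edge s)) (inj₂ (bd-edge y s')) = c∉bd y (⟦⟧-injective (⟶-unique s s'))
    edges-disjoint (inj₁ (left _))   (inj₁ ())
    edges-disjoint (inj₁ (left _))   (inj₂ ())
    edges-disjoint (inj₂ (left _))   (inj₁ ())
    edges-disjoint (inj₂ (left _))   (inj₂ ())

    classes-disjoint : ∀ {u v} → Class₁ u v → Class₂ u v → ⊥
    classes-disjoint e₁ e₂ = edges-disjoint (class₁-view e₁) (class₂-view e₂)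

  alternating-walk-relation : ∀ {o w₂ w₃ w₄ w₅} →
    sym-closure Edge₂ (B o) w₂ → sym-closure Edge₁ w₂ w₃ → sym-closure Edge₂ w₃ w₄ →
    sym-closure Edge₁ w₄ w₅ → sym-closure Edge₂ w₅ (C o) → CycleRelationₙ
  alternating-walk-relation (inj₁ (bd-edge y₁ s₁)) (inj₂ (right _)) (inj₁ (a-edge s₂)) (inj₁ (left _))
                            (inj₁ (bd-edge y₃ s₃)) =
    through-a (⟦⟧-oneOf y₁) (inj₁ ≡.refl) (⟦⟧-oneOf y₃) (⟶-closed (⟶-trans (⟶-trans s₁ s₂) s₃))
  alternating-walk-relation (inj₁ (bd-edge y₁ s₁)) (inj₂ (right _)) (inj₂ (a-edge s₂)) (inj₁ (left _))
                            (inj₁ (bd-edge y₃ s₃)) =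
    through-a (⟦⟧-oneOf y₁) (inj₂ ≡.refl) (⟦⟧-oneOf y₃) (⟶-closed (⟶-trans (⟶-trans s₁ (⟶-sym s₂)) s₃))
  alternating-walk-relation (inj₁ (bd-edge y₁ s₁)) (inj₂ (c-edge s₂)) (inj₁ (bd-edge y₂ s₃)) (inj₂ (c-edge s₄))
                            (inj₁ (bd-edge y₃ s₅)) =
    through-c (⟦⟧-oneOf y₁) (⟦⟧-oneOf y₂) (⟦⟧-oneOf y₃)
      (⟶-closed (⟶-trans (⟶-trans (⟶-trans (⟶-trans s₁ (⟶-sym s₂)) s₃) (⟶-sym s₄)) s₅))

  record Heptagon (v : V n) : Set where
    field
      {w₁ w₂ w₃ w₄ w₅ w₆} : V n
      e₁ : Class₁ v w₁
      e₂ : Class₂ w₁ w₂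
      e₃ : Class₁ w₂ w₃
      e₄ : Class₂ w₃ w₄
      e₅ : Class₁ w₄ w₅
      e₆ : Class₂ w₅ w₆
      e₇ : Class₁ w₆ v
      w₁≢w₆ : ¬ w₁ ≡ w₆

  heptagon-at-A : ∀ {o} → Heptagon (A o) → CycleRelationₙ
  heptagon-at-A h = ends (class₁-view e₁) (class₁-view e₇) w₁≢w₆
    where
    open Heptagon h
    ends : sym-closure Edge₁ (A _) w₁ → sym-closure Edge₁ w₆ (A _) → ¬ w₁ ≡ w₆ → CycleRelationₙ
    ends (inj₁ (left _))  (inj₂ (left _))  w₁≢w₆ = ⊥-elim (w₁≢w₆ ≡.refl)
    ends (inj₁ (right _)) (inj₂ (right _)) w₁≢w₆ = ⊥-elim (w₁≢w₆ ≡.refl)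
    ends (inj₁ (left _))  (inj₂ (right _)) _ =
      alternating-walk-relation (class₂-view e₂) (class₁-view e₃) (class₂-view e₄) (class₁-view e₅)
                                (class₂-view e₆)
    ends (inj₁ (right _)) (inj₂ (left _))  _ =
      alternating-walk-relation (Sum.swap (class₂-view e₆)) (Sum.swap (class₁-view e₅))
                                (Sum.swap (class₂-view e₄)) (Sum.swap (class₁-view e₃))
                                (Sum.swap (class₂-view e₂))

  module _ (b≢c : ¬ b ≡ c) (c≢d : ¬ c ≡ d) (orbits : EdgeOrbitsAre₁₂) (σ : Aut) where

    private
      τ : V n → V n
      τ = app σ

      image-classes : ∀ {u v} → Adj u v →
        (Class₁ u v × Class₁ (τ u) (τ v)) ⊎ (Class₂ u v × Class₂ (τ u) (τ v))
      image-classes {u} {v} adj =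
        proj₁ (orbits u v (τ u) (τ v) adj (proj₁ (proj₂ σ u v) adj)) (σ , inj₁ (≡.refl , ≡.refl))

    class₁-preserved : ∀ {u v} → Class₁ u v → Class₁ (τ u) (τ v)
    class₁-preserved e = [ proj₂ , (λ (e₂ , _) → ⊥-elim (classes-disjoint b≢c c≢d e e₂)) ]′
                           (image-classes (class₁-adjacent e))

    class₂-preserved : ∀ {u v} → Class₂ u v → Class₂ (τ u) (τ v)
    class₂-preserved e = [ (λ (e₁ , _) → ⊥-elim (classes-disjoint b≢c c≢d e₁ e)) , proj₂ ]′
                           (image-classes (class₂-adjacent e))

    heptagon-image : ∀ {v} → Heptagon v → Heptagon (τ v)
    heptagon-image h = record
      { e₁ = class₁-preserved e₁ ; e₂ = class₂-preserved e₂ ; e₃ = class₁-preserved e₃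
      ; e₄ = class₂-preserved e₄ ; e₅ = class₁-preserved e₅ ; e₆ = class₂-preserved e₆
      ; e₇ = class₁-preserved e₇
      ; w₁≢w₆ = w₁≢w₆ ∘ Injection.injective (↔⇒↣ (proj₁ σ))
      }
      where open Heptagon h

  heptagon-at-B : ∀ o {y} → OneOf b d y → ⟦ a ⟧ + ⟦ b ⟧ - ⟦ c ⟧ + ⟦ y ⟧ ≡ ⟦ c ⟧ mod + n → Heptagon (B o)
  heptagon-at-B o {y} y∈ closes = record
    { e₁ = inj₁ (inj₂ ≡.refl)
    ; e₂ = inj₁ (inj₁ ≡.refl)
    ; e₃ = inj₁ (inj₁ ≡.refl)
    ; e₄ = inj₂ (inj₁ (inj₁ ≡.refl))
    ; e₅ = inj₂ (inj₂ (inj₂ (-ₙ+ₙ j₂ c)))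
    ; e₆ = y-edge y∈
    ; e₇ = inj₂ (inj₂ (inj₂ (step⇒+ₙ o→j₃)))
    ; w₁≢w₆ = λ ()
    }
    where
    j₁ j₂ k j₃ : Fin n
    j₁ = o +ₙ a
    j₂ = j₁ +ₙ b
    k  = j₂ -ₙ c
    j₃ = k +ₙ y
    y-edge : OneOf b d y → Class₂ (B k) (C j₃)
    y-edge (inj₁ ≡.refl) = inj₂ (inj₁ (inj₁ ≡.refl))
    y-edge (inj₂ ≡.refl) = inj₂ (inj₂ (inj₁ ≡.refl))
    o→j₃ : ⟦ o ⟧ ⟶[ ⟦ c ⟧ ] ⟦ j₃ ⟧ mod + n
    o→j₃ = ⟶-resp closes (⟶-trans (⟶-trans (⟶-trans (⟦⟧-step o a ≡.refl) (⟦⟧-step j₁ b ≡.refl))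
                                              (⟶-sym (⟦⟧-step k c (-ₙ+ₙ j₂ c))))
                                   (⟦⟧-step k y ≡.refl))

  cycle-relation : ¬ b ≡ c → ¬ c ≡ d → VertexTransitive → EdgeOrbitsAre₁₂ →
                   ∀ {y} → OneOf b d y → ⟦ a ⟧ + ⟦ b ⟧ - ⟦ c ⟧ + ⟦ y ⟧ ≡ ⟦ c ⟧ mod + n → CycleRelationₙ
  cycle-relation b≢c c≢d transitive orbits y∈ closes =
    heptagon-at-A (≡.subst Heptagon σB≡A (heptagon-image b≢c c≢d orbits σ (heptagon-at-B o y∈ closes)))
    where
    o : Fin n
    o = [ 0 ]ₙ
    σ : Aut
    σ = proj₁ (transitive (B o) (A o))
    σB≡A : app σ (B o) ≡ A o
    σB≡A = proj₂ (transitive (B o) (A o))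

-- Reduction to n = 8

no-prime-divisor⇒1 : ∀ m .{{_ : NonZero m}} → (∀ p → Prime p → ¬ p ∣ m) → m ≡ 1
no-prime-divisor⇒1 m prime-free with factorise m
... | record { factors = [] ; isFactorisation = m≡1 } = m≡1
... | record { factors = p ∷ ps ; isFactorisation = m≡p*ps ; factorsPrime = p-prime All.∷ _ } =
  ⊥-elim (prime-free p p-prime (divides (product ps) (≡.trans m≡p*ps (ℕ.*-comm p (product ps)))))

module Reduction (n : ℕ) {{_ : NonZero n}} (a b c d : Fin n) (params : WHParams n a b c d)
                 (h : ℕ) (n≡h*2 : n ≡ h ℕ.* 2) (2a≡d-b : 2 ·ₙ a ≡ d -ₙ b) (4a≡0 : 4 ·ₙ a ≡ [ 0 ]ₙ)
                 (4c≡4b+n/2 : 4 ·ₙ c ≡ 4 ·ₙ b +ₙ [ n / 2 ]ₙ) where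

  open WH n a b c d
  open Residues n
  open WoollyHat n a b c d
  open WHParams params
  open Mod.Reasoning

  N≡2H : + n ≡ + 2 * + h
  N≡2H = ≡.trans (cong +_ (≡.trans n≡h*2 (ℕ.*-comm h 2))) (ℤ.pos-* 2 h)

  mod-2H : ∀ {x y} → x ≡ y mod + n → x ≡ y mod + 2 * + h
  mod-2H = subst (_ ≡ _ mod_) N≡2H

  mod-N : ∀ {x y} → x ≡ y mod + 2 * + h → x ≡ y mod + n
  mod-N = subst (_ ≡ _ mod_) (≡.sym N≡2H)

  4a≡0ℤ : + 4 * ⟦ a ⟧ ≡ 0ℤ mod + n
  4a≡0ℤ = begin
    + 4 * ⟦ a ⟧          ≈⟨ ⟦⟧-·ₙ 4 a ⟨
    ⟦ 4 ·ₙ a ⟧           ≡⟨ cong ⟦_⟧ 4a≡0 ⟩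
    ⟦ [ 0 ]ₙ ⟧           ≈⟨ ⟦⟧-[]ₙ 0 ⟩
    0ℤ                   ∎

  2a≢0ℤ : ¬ (+ 2 * ⟦ a ⟧ ≡ 0ℤ mod + n)
  2a≢0ℤ 2a≡0 = 2a≢0 (⟦⟧-injective (begin
    ⟦ 2 ·ₙ a ⟧           ≈⟨ ⟦⟧-·ₙ 2 a ⟩
    + 2 * ⟦ a ⟧          ≈⟨ 2a≡0 ⟩
    0ℤ                   ≈⟨ ⟦⟧-[]ₙ 0 ⟨
    ⟦ [ 0 ]ₙ ⟧           ∎))

  2a≡d-bℤ : + 2 * ⟦ a ⟧ ≡ ⟦ d ⟧ - ⟦ b ⟧ mod + n
  2a≡d-bℤ = begin
    + 2 * ⟦ a ⟧          ≈⟨ ⟦⟧-·ₙ 2 a ⟨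
    ⟦ 2 ·ₙ a ⟧           ≡⟨ cong ⟦_⟧ 2a≡d-b ⟩
    ⟦ d -ₙ b ⟧           ≈⟨ ⟦⟧-sub d b ⟩
    ⟦ d ⟧ - ⟦ b ⟧        ∎

  4c≡4b+H : + 4 * ⟦ c ⟧ ≡ + 4 * ⟦ b ⟧ + + h mod + n
  4c≡4b+H = begin
    + 4 * ⟦ c ⟧                  ≈⟨ ⟦⟧-·ₙ 4 c ⟨
    ⟦ 4 ·ₙ c ⟧                   ≡⟨ cong ⟦_⟧ 4c≡4b+n/2 ⟩
    ⟦ 4 ·ₙ b +ₙ [ n / 2 ]ₙ ⟧     ≈⟨ ⟦⟧-+ₙ (4 ·ₙ b) [ n / 2 ]ₙ ⟩
    ⟦ 4 ·ₙ b ⟧ + ⟦ [ n / 2 ]ₙ ⟧  ≈⟨ Mod.+-cong (⟦⟧-·ₙ 4 b) (⟦⟧-[]ₙ (n / 2)) ⟩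
    + 4 * ⟦ b ⟧ + + (n / 2)      ≡⟨ cong (λ k → + 4 * ⟦ b ⟧ + + k) n/2≡h ⟩
    + 4 * ⟦ b ⟧ + + h            ∎
    where
    n/2≡h : n / 2 ≡ h
    n/2≡h = ≡.trans (cong (_/ 2) n≡h*2) (m*n/n≡m h 2)

  relation : VertexTransitive → EdgeOrbitsAre₁₂ → CycleRelation (+ 2 * + h) ⟦ a ⟧ ⟦ b ⟧ ⟦ c ⟧ ⟦ d ⟧
  relation transitive orbits = subst (λ N → CycleRelation N _ _ _ _) N≡2H
    (close (closing-condition (mod-2H 4a≡0ℤ) (mod-2H 4c≡4b+H) (mod-2H 2a≡d-bℤ) (2a≢0ℤ ∘ mod-N)))
    where
    close : (∃ λ y → OneOf ⟦ b ⟧ ⟦ d ⟧ y × (⟦ a ⟧ + ⟦ b ⟧ - ⟦ c ⟧ + y ≡ ⟦ c ⟧ mod + 2 * + h)) →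
            CycleRelationₙ
    close (_ , inj₁ ≡.refl , closes) =
      cycle-relation b≢c c≢d transitive orbits (inj₁ ≡.refl) (mod-N closes)
    close (_ , inj₂ ≡.refl , closes) =
      cycle-relation b≢c c≢d transitive orbits (inj₂ ≡.refl) (mod-N closes)

  n≡8 : VertexTransitive → EdgeOrbitsAre₁₂ → n ≡ 8
  n≡8 transitive orbits =
    from-common-divisor (common-divisor (mod-2H 4a≡0ℤ) (mod-2H 4c≡4b+H) (mod-2H 2a≡d-bℤ)
                                        (relation transitive orbits))
    where
    from-common-divisor :
      (∃ λ M → + 2 * + h ≡ + 8 * M × M ∣ℤ ⟦ a ⟧ × M ∣ℤ ⟦ b ⟧ × M ∣ℤ ⟦ c ⟧ × M ∣ℤ ⟦ d ⟧) → n ≡ 8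
    from-common-divisor (M , 2H≡8M , M∣a , M∣b , M∣c , M∣d) = ≡.trans n≡8m (cong (8 ℕ.*_) m≡1)
      where
      m : ℕ
      m = ∣ M ∣
      n≡8m : n ≡ 8 ℕ.* m
      n≡8m = ≡.trans (cong ∣_∣ (≡.trans N≡2H 2H≡8M)) (ℤ.abs-* (+ 8) M)
      prime-free : ∀ p → Prime p → ¬ p ∣ m
      prime-free p p-prime p∣m = noCommonPrime p p-prime
        (∣-trans p∣m (divides 8 n≡8m)) (via M∣a) (via M∣b) (via M∣c) (via M∣d)
        where
        via : ∀ {x} → M ∣ℤ + x → p ∣ x
        via M∣x = ∣-trans p∣m (∣⇒∣ᵤ M∣x)
      m≢0 : NonZero m
      m≢0 = ℕ.≢-nonZero (ℕ.≢-nonZero⁻¹ n ∘ ≡.trans n≡8m ∘ cong (8 ℕ.*_))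
      m≡1 : m ≡ 1
      m≡1 = no-prime-divisor⇒1 m {{m≢0}} prime-free

-- ℤ₈

twoPart-2^ : ∀ k → TwoPart (2 ℕ.^ k) (2 ℕ.^ k)
twoPart-2^ k = k , ≡.refl , ∣-refl , λ 2^[1+k]∣2^k →
  ℕ.<⇒≱ (ℕ.^-monoʳ-< 2 (ℕ.s≤s (ℕ.s≤s ℕ.z≤n)) (ℕ.n<1+n k)) (∣⇒≤ {{ℕ.m^n≢0 2 k}} 2^[1+k]∣2^k)

gcd-order-four : ∀ (a : Fin 8) → ¬ 2 ·ₙ a ≡ [ 0 ]ₙ → 4 ·ₙ a ≡ [ 0 ]ₙ → gcd (toℕ a) 8 ≡ 2
gcd-order-four = from-yes (all? {n = 8} λ a →
  ¬? (2 ·ₙ a Fin.≟ [ 0 ]ₙ) →-dec (4 ·ₙ a Fin.≟ [ 0 ]ₙ) →-dec (gcd (toℕ a) 8 ℕ.≟ 2))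

gcd-cases : ∀ (c : Fin 8) → (toℕ c ≡ 0 ⊎ toℕ c ≡ 4) ⊎ (gcd (toℕ c) 8 ≡ 2 ℕ.^ 0 ⊎ gcd (toℕ c) 8 ≡ 2 ℕ.^ 1)
gcd-cases = from-yes (all? {n = 8} λ c →
  ((toℕ c ℕ.≟ 0) ⊎-dec (toℕ c ℕ.≟ 4)) ⊎-dec ((gcd (toℕ c) 8 ℕ.≟ 1) ⊎-dec (gcd (toℕ c) 8 ℕ.≟ 2)))

bd-cases : ∀ (a b c d : Fin 8) → ¬ 2 ·ₙ a ≡ [ 0 ]ₙ → 4 ·ₙ a ≡ [ 0 ]ₙ → 2 ·ₙ a ≡ d -ₙ b →
           4 ·ₙ c ≡ 4 ·ₙ b +ₙ [ 4 ]ₙ → toℕ c ≡ 0 ⊎ toℕ c ≡ 4 →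
           ((toℕ b ≡ 1 × toℕ d ≡ 5) ⊎ (toℕ b ≡ 5 × toℕ d ≡ 1))
           ⊎ ((toℕ (-ₙ b) ≡ 1 × toℕ (-ₙ d) ≡ 5) ⊎ (toℕ (-ₙ b) ≡ 5 × toℕ (-ₙ d) ≡ 1))
bd-cases = from-yes (all? {n = 8} λ a → all? {n = 8} λ b → all? {n = 8} λ c → all? {n = 8} λ d →
  ¬? (2 ·ₙ a Fin.≟ [ 0 ]ₙ) →-dec (4 ·ₙ a Fin.≟ [ 0 ]ₙ) →-dec (2 ·ₙ a Fin.≟ d -ₙ b) →-dec
  (4 ·ₙ c Fin.≟ 4 ·ₙ b +ₙ [ 4 ]ₙ) →-dec ((toℕ c ℕ.≟ 0) ⊎-dec (toℕ c ℕ.≟ 4)) →-dec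
  ((((toℕ b ℕ.≟ 1) ×-dec (toℕ d ℕ.≟ 5)) ⊎-dec ((toℕ b ℕ.≟ 5) ×-dec (toℕ d ℕ.≟ 1)))
   ⊎-dec (((toℕ (-ₙ b) ℕ.≟ 1) ×-dec (toℕ (-ₙ d) ℕ.≟ 5))
          ⊎-dec ((toℕ (-ₙ b) ℕ.≟ 5) ×-dec (toℕ (-ₙ d) ℕ.≟ 1)))))

c-cases : ∀ (a c : Fin 8) → ¬ 2 ·ₙ a ≡ [ 0 ]ₙ → 4 ·ₙ a ≡ [ 0 ]ₙ →
          (∀ s t → TwoPart (gcd (toℕ c) 8) t → TwoPart (gcd (toℕ a) 8) s → s < t) →
          toℕ c ≡ 0 ⊎ toℕ c ≡ 4
c-cases a c 2a≢0 4a≡0 twoPart-grows =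
  [ id , [ ⊥-elim ∘ too-small 0 (λ { (ℕ.s≤s ()) })
         , ⊥-elim ∘ too-small 1 (λ { (ℕ.s≤s (ℕ.s≤s ())) }) ]′ ]′ (gcd-cases c)
  where
  twoPart-a : TwoPart (gcd (toℕ a) 8) 2
  twoPart-a = subst (λ g → TwoPart g 2) (≡.sym (gcd-order-four a 2a≢0 4a≡0)) (twoPart-2^ 1)
  too-small : ∀ k → ¬ 2 < 2 ℕ.^ k → ¬ gcd (toℕ c) 8 ≡ 2 ℕ.^ k
  too-small k 2≮2^k gcd≡2^k = 2≮2^k (twoPart-grows 2 _ twoPart-c twoPart-a)
    where
    twoPart-c : TwoPart (gcd (toℕ c) 8) (2 ℕ.^ k)
    twoPart-c = subst (λ g → TwoPart g (2 ℕ.^ k)) (≡.sym gcd≡2^k) (twoPart-2^ k)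

classification-mod-8 : ∀ {n} {{_ : NonZero n}} (a b c d : Fin n) → n ≡ 8
  → ¬ (2 ·ₙ a ≡ [ 0 ]ₙ) → 4 ·ₙ a ≡ [ 0 ]ₙ → 2 ·ₙ a ≡ d -ₙ b → 4 ·ₙ c ≡ 4 ·ₙ b +ₙ [ n / 2 ]ₙ
  → (∀ s t → TwoPart (gcd (toℕ c) n) t → TwoPart (gcd (toℕ a) n) s → s < t)
  → n ≡ 8
    × (toℕ c ≡ 0 ⊎ toℕ c ≡ 4)
    × (((toℕ b ≡ 1 × toℕ d ≡ 5) ⊎ (toℕ b ≡ 5 × toℕ d ≡ 1))
       ⊎ ((toℕ (-ₙ b) ≡ 1 × toℕ (-ₙ d) ≡ 5) ⊎ (toℕ (-ₙ b) ≡ 5 × toℕ (-ₙ d) ≡ 1)))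
classification-mod-8 a b c d ≡.refl 2a≢0 4a≡0 2a≡d-b 4c≡4b+4 twoPart-grows =
  ≡.refl , c∈04 , bd-cases a b c d 2a≢0 4a≡0 2a≡d-b 4c≡4b+4 c∈04
  where
  c∈04 : toℕ c ≡ 0 ⊎ toℕ c ≡ 4
  c∈04 = c-cases a c 2a≢0 4a≡0 twoPart-grows

proposition4p7 : (n : ℕ) {{_ : NonZero n}} (a b c d : Fin n)
    → WHParams n a b c d
    → WH.VertexTransitive n a b c d
    → 2 ∣ n
    → ¬ (b ≡ [ 0 ]ₙ) → ¬ (d ≡ [ 0 ]ₙ)
    → 2 ·ₙ a ≡ d -ₙ b
    → (∀ s t → TwoPart (gcd (toℕ c) n) t → TwoPart (gcd (toℕ a) n) s → s < t)
    → WH.EdgeOrbitsAre₁₂ n a b c d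
    → 4 ·ₙ a ≡ [ 0 ]ₙ
    → 4 ·ₙ c ≡ 4 ·ₙ b +ₙ [ n / 2 ]ₙ
    → n ≡ 8
      × (toℕ c ≡ 0 ⊎ toℕ c ≡ 4)
      × (((toℕ b ≡ 1 × toℕ d ≡ 5) ⊎ (toℕ b ≡ 5 × toℕ d ≡ 1))
         ⊎ ((toℕ (-ₙ b) ≡ 1 × toℕ (-ₙ d) ≡ 5) ⊎ (toℕ (-ₙ b) ≡ 5 × toℕ (-ₙ d) ≡ 1)))
proposition4p7 n a b c d params transitive (divides h n≡h*2) _ _ 2a≡d-b twoPart-grows orbits
               4a≡0 4c≡4b+n/2 =
  classification-mod-8 a b c d n≡8 (WHParams.2a≢0 params) 4a≡0 2a≡d-b 4c≡4b+n/2 twoPart-grows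
  where
  n≡8 : n ≡ 8
  n≡8 = Reduction.n≡8 n a b c d params h n≡h*2 2a≡d-b 4a≡0 4c≡4b+n/2 transitive orbits
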